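{- Let $\mathcal R=(\mathcal R_{amplitude},\mathcal R_{space},\mathcal R_{time})$ be a regular boundclass triple, let $\mathcal B\in\{\mathcal R_{amplitude},\mathcal R_{space},\mathcal R_{time}\}$, let $\mathfrak f(x_1,\dots,x_n)$ ($n\ge 0$) be an $n$-ary function on natural numbers, and let $\mathfrak b$ be an $n$-ary bound from $\mathcal B$ with $\mathfrak f=O(\mathfrak b)$. Then $\mathfrak f\preceq\mathcal B$.
   Context: A pterm $\mathfrak p(x_1,\dots,x_n)$ is an elementary (choice-free, first-order arithmetic) formula $p(y,\vec x)$ with designated value variable $y$ such that Peano Arithmetic proves $\forall\vec x\exists!y\,p(y,\vec x)$; it is identified with the function it represents. A bound is a monotone pterm ($x_i\le y_i$ for all $i$ implies $\mathfrak p(\vec x)\le\mathfrak p(\vec y)$). A boundclass is a set of bounds closed under renaming of variables. $f=O(g)$ for $n$-ary $f,g$ means there is $k$ with $f(\vec a)\le k\,g(\vec a)+k$ for all $\vec a$. For $m$-ary $\mathfrak b$ and $n$-ary $\mathfrak c$, $\mathfrak b\preceq\mathfrak c$ iff $m=n$ and $\mathfrak b(\vec a)\le\mathfrak c(\vec a)$ for all $\vec a$; $\mathfrak b\preceq\mathcal C$ iff $\mathfrak b\preceq\mathfrak c$ for some $\mathfrak c\in\mathcal C$. The linear closure of a set of bounds is the smallest boundclass containing it and $0$ and closed under $\mathfrak b\mapsto\mathfrak b+1$ and $(\mathfrak b,\mathfrak c)\mapsto\mathfrak b+\mathfrak c$; polynomial closure additionally under $\times$; "linearly/polynomially closed" means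 equal to its closure. A boundclass triple $\mathcal R=(\mathcal R_{amplitude},\mathcal R_{space},\mathcal R_{time})$ is regular iff: (1) for every bound $\mathfrak b(\vec s)$ in the union of the three components, the computability-logic game $\sqcap\sqcup z(z=\mathfrak b(|s_1|,\dots,|s_n|))$ (environment picks $\vec s$, machine must respond with the value) has a solution by an interactive Turing machine running in amplitude, space and time bounded by some triple from $\mathcal R_{amplitude}\times\mathcal R_{space}\times\mathcal R_{time}$ (as functions of the size of the environment's moves), effectively constructible from $\mathfrak b$, where $|x|$ is binary length; (2) $x\preceq\mathcal R_{amplitude}$, $|x|\preceq\mathcal R_{space}$ and $x,x^2,x^3,\dots\preceq\mathcal R_{time}$; (3) all three components are linearly closed and $\mathcal R_{time}$ is polynomially closed; (4) for each component $\mathcal B$, whenever $\mathfrak b(x_1,\dots,x_n)\in\mathcal B$ and $\mathfrak c_1,\dots,\mathfrak c_n\in\mathcal R_{amplitude}\cup\mathcal R_{space}$, $\mathfrak b(\mathfrak c_1,\dots,\mathfrak c_n)\preceq\mathcal B$; (5) for every $(\mathfrak a,\mathfrak s,\mathfrak t)$ in $\mathcal R_{amplitude}\times\mathcal R_{space}\times\mathcal R_{time}$ there is $(\mathfrak a',\mathfrak s',\mathfrak t')$ in that product with $\mathfrak a\preceq\mathfrak a'$, $\mathfrak s\preceq\mathfrak s'$, $\mathfrak t\preceq\mathfrak t'$ and $|\mathfrak t'(\vec x)|\preceq\mathfrak s'(\vec x)\preceq\mathfrak a'(\vec x)\preceq\mathfrak t'(\vec x)$. -}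

module Defs where

open import Data.Nat using (ℕ; zero; suc; _+_; _*_; _^_; _≤_)
open import Data.Nat.Logarithm using (⌊log₂_⌋)
open import Data.Fin using (Fin; _↑ˡ_; _↑ʳ_)
import Data.Fin as Fin
open import Relation.Binary.PropositionalEquality using (_≡_)
open import Data.Sum using (_⊎_; [_,_])
open import Data.Product using (Σ; ∃; _×_; _,_)
open import Function using (_∘_)

Args : ℕ → Set
Args n = Fin n → ℕ

Fun : ℕ → Set
Fun n = Args n → ℕ

-- binary length |x| of x (|0| = 1, the length of the string "0")
∣_∣ᵇ : ℕ → ℕ
∣ x ∣ᵇ = suc ⌊log₂ x ⌋

_≤ᵛ_ : ∀ {n} → Args n → Args n → Set
u ≤ᵛ v = ∀ i → u i ≤ v i

Monotone : ∀ {n} → Fun n → Set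
Monotone {n} f = ∀ (u v : Args n) → u ≤ᵛ v → f u ≤ f v

_isO_ : ∀ {n} → Fun n → Fun n → Set
f isO g = ∃ λ k → ∀ a → f a ≤ k * g a + k

_⪯_ : ∀ {n} → Fun n → Fun n → Set
f ⪯ g = ∀ a → f a ≤ g a

Class : Set₁
Class = (n : ℕ) → Fun n → Set

_⪯ᶜ_ : ∀ {n} → Fun n → Class → Set
_⪯ᶜ_ {n} f 𝓒 = Σ (Fun n) λ c → 𝓒 n c × (f ⪯ c)

-- Variable renaming: an n-ary bound b(x_0..x_{n-1}) renamed via
-- ρ : Fin n → Fin m into an m-ary bound (variables may be identified
-- or dummy variables added).
rename : ∀ {n m} → (Fin n → Fin m) → Fun n → Fun m
rename ρ b a = b (a ∘ ρ)

-- b(x⃗) + c(y⃗), b(x⃗) × c(y⃗) on disjoint variable lists (arity m + n);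
-- sharing of variables is obtained afterwards by renaming.
_⊕_ : ∀ {m n} → Fun m → Fun n → Fun (m + n)
_⊕_ {m} b c a = b (a ∘ (_↑ˡ _)) + c (a ∘ (m ↑ʳ_))

_⊗_ : ∀ {m n} → Fun m → Fun n → Fun (m + n)
_⊗_ {m} b c a = b (a ∘ (_↑ˡ _)) * c (a ∘ (m ↑ʳ_))

zero₀ : Fun 0
zero₀ _ = 0

plus1 : ∀ {n} → Fun n → Fun n
plus1 b a = b a + 1

record IsBoundclass (𝓑 : Class) : Set where
  field
    monotone : ∀ {n} (b : Fun n) → 𝓑 n b → Monotone b
    closed-rename : ∀ {n m} (ρ : Fin n → Fin m) (b : Fun n) → 𝓑 n b → 𝓑 m (rename ρ b)

record LinearlyClosed (𝓑 : Class) : Set where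
  field
    has-zero : 𝓑 0 zero₀
    has-suc  : ∀ {n} (b : Fun n) → 𝓑 n b → 𝓑 n (plus1 b)
    has-plus : ∀ {m n} (b : Fun m) (c : Fun n) → 𝓑 m b → 𝓑 n c → 𝓑 (m + n) (b ⊕ c)

record PolynomiallyClosed (𝓑 : Class) : Set where
  field
    linear    : LinearlyClosed 𝓑
    has-times : ∀ {m n} (b : Fun m) (c : Fun n) → 𝓑 m b → 𝓑 n c → 𝓑 (m + n) (b ⊗ c)

idᵘ : Fun 1
idᵘ a = a Fin.zero

lenᵘ : Fun 1
lenᵘ a = ∣ a Fin.zero ∣ᵇ

powᵘ : ℕ → Fun 1
powᵘ k a = a Fin.zero ^ k

_∪ᶜ_ : Class → Class → Class
(𝓐 ∪ᶜ 𝓒) n b = 𝓐 n b ⊎ 𝓒 n b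

data Component : Set where
  amplitude space time : Component

component : Class → Class → Class → Component → Class
component 𝓐 𝓢 𝓣 amplitude = 𝓐
component 𝓐 𝓢 𝓣 space     = 𝓢
component 𝓐 𝓢 𝓣 time      = 𝓣

-- Regularity conditions (2)–(5) of a boundclass triple (amplitude, space, time).
-- Condition (1) (ITM-computability of the bounds) is not formalized.
record Regular (𝓐 𝓢 𝓣 : Class) : Set where
  field
    bc-amp   : IsBoundclass 𝓐
    bc-space : IsBoundclass 𝓢
    bc-time  : IsBoundclass 𝓣
    id-amp     : idᵘ ⪯ᶜ 𝓐
    len-space  : lenᵘ ⪯ᶜ 𝓢
    pow-time   : ∀ k → 1 ≤ k → powᵘ k ⪯ᶜ 𝓣
    lin-amp    : LinearlyClosed 𝓐
    lin-space  : LinearlyClosed 𝓢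
    poly-time  : PolynomiallyClosed 𝓣
    compose : ∀ (κ : Component) {n m} (b : Fun n) → component 𝓐 𝓢 𝓣 κ n b
              → (c : Fin n → Fun m) → (∀ i → (𝓐 ∪ᶜ 𝓢) m (c i))
              → (λ a → b (λ i → c i a)) ⪯ᶜ component 𝓐 𝓢 𝓣 κ
    tight : ∀ {n} (a s t : Fun n) → 𝓐 n a → 𝓢 n s → 𝓣 n t
            → Σ (Fun n) λ a' → Σ (Fun n) λ s' → Σ (Fun n) λ t' →
                𝓐 n a' × 𝓢 n s' × 𝓣 n t' × a ⪯ a' × s ⪯ s' × t ⪯ t'
                × (λ x → ∣ t' x ∣ᵇ) ⪯ s' × s' ⪯ a' × a' ⪯ t'

-- A linearly closed boundclass already contains, up to ⪯, every  k·b + k  with  b  in it: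
-- k copies of  b  are added on disjoint variable lists and the two copies of each variable
-- are then identified by renaming (monotonicity makes the renamed sum dominate b + c
-- pointwise), and  +k  is  k  applications of  +1.  Every component of a regular triple
-- is such a class (time being even polynomially closed).
module Submission where

open import Defs
open import Data.Nat using (ℕ; zero; suc; _+_; _*_; _≤_; z≤n)
open import Data.Nat.Properties using (≤-refl; ≤-trans; ≤-reflexive; +-mono-≤; +-monoˡ-≤; +-identityʳ; +-comm; +-assoc)
open import Data.Fin using (Fin; splitAt; _↑ˡ_; _↑ʳ_)
open import Data.Fin.Properties using (splitAt-↑ˡ; splitAt-↑ʳ)
open import Data.Sum using ([_,_])
open import Data.Product using (_,_)
open import Function using (id; _∘_)
open import Relation.Binary.PropositionalEquality using (_≡_; refl; sym; cong; module ≡-Reasoning)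

diagonal : ∀ n → Fin (n + n) → Fin n
diagonal n = [ id , id ] ∘ splitAt n

diagonal-↑ˡ : ∀ n (i : Fin n) → diagonal n (i ↑ˡ n) ≡ i
diagonal-↑ˡ n i = cong [ id , id ] (splitAt-↑ˡ n i n)

diagonal-↑ʳ : ∀ n (i : Fin n) → diagonal n (n ↑ʳ i) ≡ i
diagonal-↑ʳ n i = cong [ id , id ] (splitAt-↑ʳ n n i)

module LinearlyClosedBoundclass {𝓑 : Class} (bc : IsBoundclass 𝓑) (lc : LinearlyClosed 𝓑) where
  open IsBoundclass bc
  open LinearlyClosed lc

  _+ᶠ_ : ∀ {n} → Fun n → Fun n → Fun n
  _+ᶠ_ {n} b c = rename (diagonal n) (b ⊕ c)

  +ᶠ-∈ : ∀ {n} {b c : Fun n} → 𝓑 n b → 𝓑 n c → 𝓑 n (b +ᶠ c)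
  +ᶠ-∈ {n} {b} {c} b∈ c∈ = closed-rename (diagonal n) (b ⊕ c) (has-plus b c b∈ c∈)

  +ᶠ-≥ : ∀ {n} {b c : Fun n} → 𝓑 n b → 𝓑 n c → ∀ a → b a + c a ≤ (b +ᶠ c) a
  +ᶠ-≥ {n} {b} {c} b∈ c∈ a = +-mono-≤
    (monotone b b∈ a _ (λ i → ≤-reflexive (cong a (sym (diagonal-↑ˡ n i)))))
    (monotone c c∈ a _ (λ i → ≤-reflexive (cong a (sym (diagonal-↑ʳ n i)))))

  zeroᶠ : ∀ n → Fun n
  zeroᶠ n = rename (λ ()) zero₀

  zeroᶠ-∈ : ∀ n → 𝓑 n (zeroᶠ n)
  zeroᶠ-∈ n = closed-rename (λ ()) zero₀ has-zero

  scale : ∀ {n} → ℕ → Fun n → Fun n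
  scale zero    b = zeroᶠ _
  scale (suc k) b = b +ᶠ scale k b

  scale-∈ : ∀ {n} k {b : Fun n} → 𝓑 n b → 𝓑 n (scale k b)
  scale-∈ zero    b∈ = zeroᶠ-∈ _
  scale-∈ (suc k) b∈ = +ᶠ-∈ b∈ (scale-∈ k b∈)

  *-≤-scale : ∀ {n} k {b : Fun n} → 𝓑 n b → ∀ a → k * b a ≤ scale k b a
  *-≤-scale zero    b∈ a = z≤n
  *-≤-scale (suc k) {b} b∈ a = ≤-trans
    (+-mono-≤ (≤-refl {b a}) (*-≤-scale k b∈ a))
    (+ᶠ-≥ b∈ (scale-∈ k b∈) a)

  addConst : ∀ {n} → ℕ → Fun n → Fun n
  addConst zero    c = c
  addConst (suc j) c = plus1 (addConst j c)

  addConst-∈ : ∀ {n} j {c : Fun n} → 𝓑 n c → 𝓑 n (addConst j c)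
  addConst-∈ zero    c∈ = c∈
  addConst-∈ (suc j) c∈ = has-suc _ (addConst-∈ j c∈)

  addConst-≡ : ∀ {n} j (c : Fun n) a → addConst j c a ≡ c a + j
  addConst-≡ zero    c a = sym (+-identityʳ (c a))
  addConst-≡ (suc j) c a = begin
    addConst j c a + 1 ≡⟨ cong (_+ 1) (addConst-≡ j c a) ⟩
    c a + j + 1        ≡⟨ +-assoc (c a) j 1 ⟩
    c a + (j + 1)      ≡⟨ cong (c a +_) (+-comm j 1) ⟩
    c a + suc j        ∎
    where open ≡-Reasoning

  isO⇒⪯ᶜ : ∀ {n} {f b : Fun n} → 𝓑 n b → f isO b → f ⪯ᶜ 𝓑
  isO⇒⪯ᶜ {b = b} b∈ (k , f≤kb+k) =
    addConst k (scale k b) , addConst-∈ k (scale-∈ k b∈) ,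
    λ a → ≤-trans (f≤kb+k a)
            (≤-trans (+-monoˡ-≤ k (*-≤-scale k b∈ a))
                     (≤-reflexive (sym (addConst-≡ k (scale k b) a))))

componentIsBoundclass : ∀ {𝓐 𝓢 𝓣} → Regular 𝓐 𝓢 𝓣 → ∀ κ → IsBoundclass (component 𝓐 𝓢 𝓣 κ)
componentIsBoundclass R amplitude = Regular.bc-amp R
componentIsBoundclass R space     = Regular.bc-space R
componentIsBoundclass R time      = Regular.bc-time R

componentLinearlyClosed : ∀ {𝓐 𝓢 𝓣} → Regular 𝓐 𝓢 𝓣 → ∀ κ → LinearlyClosed (component 𝓐 𝓢 𝓣 κ)
componentLinearlyClosed R amplitude = Regular.lin-amp R
componentLinearlyClosed R space     = Regular.lin-space R
componentLinearlyClosed R time      = PolynomiallyClosed.linear (Regular.poly-time R)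

lemma2p3 : (𝓐 𝓢 𝓣 : Class) → Regular 𝓐 𝓢 𝓣 → (κ : Component) →
           (n : ℕ) (f : Fun n) (b : Fun n) → component 𝓐 𝓢 𝓣 κ n b →
           f isO b → f ⪯ᶜ component 𝓐 𝓢 𝓣 κ
lemma2p3 𝓐 𝓢 𝓣 R κ n f b b∈ = isO⇒⪯ᶜ b∈
  where open LinearlyClosedBoundclass (componentIsBoundclass R κ) (componentLinearlyClosed R κ)
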